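{- Let $\mathbf{H}$ be a prelinear semihoop, and let $\mathbf{K}(\hat{\mathbf{H}})$ and $h:H\to K(\hat H)$, $h(x)=[x\cdot x,x]$, be as described in the context. Then for every state $w$ of $\mathbf{H}$ there is a state $\sigma$ of the abelian $\ell$-group $\mathbf{K}(\hat{\mathbf{H}})$ such that $w=\sigma\circ h$. Conversely, for every state $\sigma$ of $\mathbf{K}(\hat{\mathbf{H}})$, the map $\sigma\circ h$ is a state of $\mathbf{H}$.
   Context: A semihoop is an algebra $(H,\cdot,\to,\wedge,1)$ such that $(H,\wedge,1)$ is a meet-semilattice with top $1$; $(H,\cdot,1)$ is a commutative monoid isotone w.r.t. the order; $c_1\le c_2$ iff $c_1\to c_2=1$; and $(c_1\cdot c_2)\to c_3=c_1\to(c_2\to c_3)$. It is prelinear if $(x\to y)\to z\le((y\to x)\to z)\to z$; then $x\vee y:=((x\to y)\to y)\wedge((y\to x)\to x)$ is the lattice join and $\hat{\mathbf{H}}=(H,\cdot,\wedge,\vee,1)$ is an $\ell$-monoid. Construction of $\mathbf{K}(\hat{\mathbf{H}})$: on $H\times H$ put $(x,y)\sim(x',y')$ iff there is $z\in H$ with $z\cdot x\cdot y'=z\cdot x'\cdot y$; $K(\hat H)=H\times H/\sim$ with classes $[x,y]$; $[x,y]+[x',y']=[x\cdot x',y\cdot y']$, neutral element $[1,1]$, $-[x,y]=[y,x]$; order $[x_1,y_1]\le[x_2,y_2]$ iff there is $z\in H$ with $z\cdot x_1\cdot y_2\le z\cdot y_1\cdot x_2$; this is an abelian $\ell$-group with join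 $[x_1,y_1]\sqcup[x_2,y_2]=[x_1 x_2,(x_1 y_2)\wedge(x_2 y_1)]$ and meet $[x_1,y_1]\sqcap[x_2,y_2]=[(x_1 y_2)\wedge(x_2 y_1),y_1 y_2]$. A state of a prelinear semihoop $\mathbf{H}$ is a map $w:H\to\mathbb{R}^-$ (non-positive reals) with $w(1)=0$, $w(x\cdot y)=w(x)+w(y)$, and $x\le y\Rightarrow w(x)\le w(y)$. A state of an abelian $\ell$-group $\mathbf{G}$ is a group homomorphism $\sigma:G\to(\mathbb{R},+)$ with $\sigma(x)\ge0$ whenever $x\ge0$. -}

module Defs where

open import Data.Product using (Σ; ∃; _×_; _,_)
open import Relation.Binary.PropositionalEquality using (_≡_)
open import Relation.Binary.Structures using (IsTotalOrder)
open import Algebra.Structures using (IsCommutativeRing)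
open import Relation.Nullary using (¬_)

-- The real numbers, axiomatised as a Dedekind-complete ordered field.
-- (agda-stdlib has no reals; any model of these axioms is isomorphic
--  to ℝ, so quantifying over all models is faithful.)

record RealNumbers : Set₁ where
  infixl 6 _+_
  infixl 7 _*_
  infix 4 _≤_
  field
    ℝ   : Set
    0#  : ℝ
    1#  : ℝ
    _+_ : ℝ → ℝ → ℝ
    _*_ : ℝ → ℝ → ℝ
    -_  : ℝ → ℝ
    _≤_ : ℝ → ℝ → Set
    isCommutativeRing : IsCommutativeRing _≡_ _+_ _*_ -_ 0# 1#
    0≢1     : ¬ (0# ≡ 1#)
    inverse : ∀ x → ¬ (x ≡ 0#) → ∃ λ y → x * y ≡ 1#
    isTotalOrder : IsTotalOrder _≡_ _≤_
    +-mono-≤ : ∀ x y z → x ≤ y → x + z ≤ y + z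
    *-pos    : ∀ x y → 0# ≤ x → 0# ≤ y → 0# ≤ x * y
    complete : (P : ℝ → Set) → (∃ λ x → P x) → (∃ λ b → ∀ x → P x → x ≤ b) →
               ∃ λ s → (∀ x → P x → x ≤ s) × (∀ b → (∀ x → P x → x ≤ b) → s ≤ b)

record PrelinearSemihoop : Set₁ where
  infixl 7 _·_
  infixr 5 _⇒_
  infixl 6 _∧_
  infix 4 _≤_
  field
    H   : Set
    _·_ : H → H → H
    _⇒_ : H → H → H
    _∧_ : H → H → H
    𝟙   : H
  _≤_ : H → H → Set
  x ≤ y = x ∧ y ≡ x
  field
    ∧-idem  : ∀ x → x ∧ x ≡ x
    ∧-comm  : ∀ x y → x ∧ y ≡ y ∧ x
    ∧-assoc : ∀ x y z → (x ∧ y) ∧ z ≡ x ∧ (y ∧ z)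
    ∧-top   : ∀ x → x ∧ 𝟙 ≡ x
    ·-comm  : ∀ x y → x · y ≡ y · x
    ·-assoc : ∀ x y z → (x · y) · z ≡ x · (y · z)
    ·-identity : ∀ x → 𝟙 · x ≡ x
    ·-isotone  : ∀ x y z → x ≤ y → x · z ≤ y · z
    ≤⇒⇒≡𝟙 : ∀ x y → x ≤ y → x ⇒ y ≡ 𝟙
    ⇒≡𝟙⇒≤ : ∀ x y → x ⇒ y ≡ 𝟙 → x ≤ y
    curry : ∀ x y z → (x · y) ⇒ z ≡ x ⇒ (y ⇒ z)
    prelinear : ∀ x y z → (x ⇒ y) ⇒ z ≤ ((y ⇒ x) ⇒ z) ⇒ z

module _ (R : RealNumbers) (S : PrelinearSemihoop) where
  open RealNumbers R renaming (_≤_ to _≤ℝ_; _+_ to _+ℝ_)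
  open PrelinearSemihoop S

  record IsState (w : H → ℝ) : Set where
    field
      nonpos : ∀ x → w x ≤ℝ 0#
      unit   : w 𝟙 ≡ 0#
      mult   : ∀ x y → w (x · y) ≡ w x +ℝ w y
      mono   : ∀ x y → x ≤ y → w x ≤ℝ w y

  -- K(Ĥ): carrier H × H modulo ~, represented as a setoid.
  K : Set
  K = H × H

  _∼_ : K → K → Set
  (x , y) ∼ (x' , y') = ∃ λ z → z · x · y' ≡ z · x' · y

  _⊕_ : K → K → K
  (x , y) ⊕ (x' , y') = (x · x' , y · y')

  𝟘K : K
  𝟘K = (𝟙 , 𝟙)

  _⊑_ : K → K → Set
  (x₁ , y₁) ⊑ (x₂ , y₂) = ∃ λ z → z · x₁ · y₂ ≤ z · y₁ · x₂

  record IsKState (σ : K → ℝ) : Set where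
    field
      wellDefined : ∀ a b → a ∼ b → σ a ≡ σ b
      additive    : ∀ a b → σ (a ⊕ b) ≡ σ a +ℝ σ b
      positive    : ∀ a → 𝟘K ⊑ a → 0# ≤ℝ σ a

  h : H → K
  h x = (x · x , x)

module Submission where

-- Forward: a state w extends to K(Ĥ) as the "difference" σ[x, y] = w x − w y.
-- Since w turns · into + and preserves ≤, a common factor z in
-- z·x·y' = z·x'·y (resp. z·x·y' ≤ z·y·x') can be cancelled after applying w,
-- which gives well-definedness (resp. positivity); additivity is a
-- rearrangement in ℝ, and σ(h x) = (w x + w x) − w x = w x.
--
-- Backward: a state σ of K(Ĥ) kills every diagonal pair [p, p], hence
-- σ[y, x] = −σ[x, y]; it is nonnegative on [x, y] whenever y ≤ x.  With
-- the semihoop inequalities x·x ≤ x and (x ≤ y ⇒ y·(x·x) ≤ (y·y)·x) and the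
-- identity h(x·y) = h x ⊕ h y this makes σ ∘ h a state of H.

open import Defs
open import Data.Product using (∃; _×_; _,_)
open import Relation.Binary.PropositionalEquality
  using (_≡_; refl; sym; trans; cong; cong₂; subst₂; isEquivalence; module ≡-Reasoning)
open import Algebra.Bundles using (CommutativeRing; AbelianGroup; CommutativeSemigroup)
import Algebra.Properties.AbelianGroup as AbelianGroupProperties
import Algebra.Properties.CommutativeSemigroup as CommutativeSemigroupProperties

module RealFacts (R : RealNumbers) where
  open RealNumbers R renaming (_≤_ to _≤ℝ_; _+_ to _+ℝ_)

  ℝ-ring : CommutativeRing _ _
  ℝ-ring = record { isCommutativeRing = isCommutativeRing }

  +-abelianGroup : AbelianGroup _ _
  +-abelianGroup = CommutativeRing.+-abelianGroup ℝ-ring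

  open AbelianGroup +-abelianGroup public
    using (assoc; comm; identityˡ; identityʳ; inverseˡ; inverseʳ)
  open AbelianGroupProperties +-abelianGroup public
    using (∙-cancelˡ; ∙-cancelʳ; identityʳ-unique; inverseʳ-unique; ⁻¹-∙-comm)
  open CommutativeSemigroupProperties (CommutativeRing.+-commutativeSemigroup ℝ-ring) public
    using (interchange)

  infixl 6 _-ℝ_
  _-ℝ_ : ℝ → ℝ → ℝ
  a -ℝ b = a +ℝ (- b)

  sub-add-cancel : ∀ a b d → (a -ℝ b) +ℝ (b +ℝ d) ≡ a +ℝ d
  sub-add-cancel a b d = begin
    (a +ℝ - b) +ℝ (b +ℝ d)  ≡⟨ assoc a (- b) (b +ℝ d) ⟩
    a +ℝ (- b +ℝ (b +ℝ d))  ≡⟨ cong (a +ℝ_) (sym (assoc (- b) b d)) ⟩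
    a +ℝ ((- b +ℝ b) +ℝ d)  ≡⟨ cong (λ t → a +ℝ (t +ℝ d)) (inverseˡ b) ⟩
    a +ℝ (0# +ℝ d)          ≡⟨ cong (a +ℝ_) (identityˡ d) ⟩
    a +ℝ d                  ∎
    where open ≡-Reasoning

  -- Equal cross sums give equal differences: the real-number shadow of ∼.
  cross-sum⇒diff≡ : ∀ a b c d → a +ℝ d ≡ c +ℝ b → a -ℝ b ≡ c -ℝ d
  cross-sum⇒diff≡ a b c d e = ∙-cancelʳ (b +ℝ d) (a -ℝ b) (c -ℝ d) (begin
    (a -ℝ b) +ℝ (b +ℝ d)  ≡⟨ sub-add-cancel a b d ⟩
    a +ℝ d                ≡⟨ e ⟩
    c +ℝ b                ≡⟨ sym (sub-add-cancel c d b) ⟩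
    (c -ℝ d) +ℝ (d +ℝ b)  ≡⟨ cong ((c -ℝ d) +ℝ_) (comm d b) ⟩
    (c -ℝ d) +ℝ (b +ℝ d)  ∎)
    where open ≡-Reasoning

  diff-of-sums : ∀ a b c d → (a +ℝ c) -ℝ (b +ℝ d) ≡ (a -ℝ b) +ℝ (c -ℝ d)
  diff-of-sums a b c d = begin
    (a +ℝ c) +ℝ - (b +ℝ d)     ≡⟨ cong ((a +ℝ c) +ℝ_) (sym (⁻¹-∙-comm b d)) ⟩
    (a +ℝ c) +ℝ (- b +ℝ - d)   ≡⟨ interchange a c (- b) (- d) ⟩
    (a +ℝ - b) +ℝ (c +ℝ - d)   ∎
    where open ≡-Reasoning

  double-minus-self : ∀ a → (a +ℝ a) -ℝ a ≡ a
  double-minus-self a = begin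
    (a +ℝ a) +ℝ - a   ≡⟨ assoc a a (- a) ⟩
    a +ℝ (a +ℝ - a)   ≡⟨ cong (a +ℝ_) (inverseʳ a) ⟩
    a +ℝ 0#           ≡⟨ identityʳ a ⟩
    a                 ∎
    where open ≡-Reasoning

  +-monoʳ-≤ : ∀ a b c → a ≤ℝ b → c +ℝ a ≤ℝ c +ℝ b
  +-monoʳ-≤ a b c p = subst₂ _≤ℝ_ (comm a c) (comm b c) (+-mono-≤ a b c p)

  +-cancelˡ-≤ : ∀ a b c → c +ℝ a ≤ℝ c +ℝ b → a ≤ℝ b
  +-cancelˡ-≤ a b c p =
    subst₂ _≤ℝ_ (neg-cancel a) (neg-cancel b) (+-monoʳ-≤ (c +ℝ a) (c +ℝ b) (- c) p)
    where
    neg-cancel : ∀ t → - c +ℝ (c +ℝ t) ≡ t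
    neg-cancel t = trans (sym (assoc (- c) c t))
                         (trans (cong (_+ℝ t) (inverseˡ c)) (identityˡ t))

  ≤⇒0≤diff : ∀ a b → a ≤ℝ b → 0# ≤ℝ b -ℝ a
  ≤⇒0≤diff a b p = subst₂ _≤ℝ_ (inverseʳ a) refl (+-mono-≤ a b (- a) p)

  0≤diff⇒≤ : ∀ a b → 0# ≤ℝ b -ℝ a → a ≤ℝ b
  0≤diff⇒≤ a b p = subst₂ _≤ℝ_ (identityˡ a) b-a+a≡b (+-mono-≤ 0# (b -ℝ a) a p)
    where
    b-a+a≡b : (b -ℝ a) +ℝ a ≡ b
    b-a+a≡b = trans (assoc b (- a) a) (trans (cong (b +ℝ_) (inverseˡ a)) (identityʳ b))

  0≤neg⇒≤0 : ∀ a → 0# ≤ℝ - a → a ≤ℝ 0#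
  0≤neg⇒≤0 a p = 0≤diff⇒≤ a 0# (subst₂ _≤ℝ_ refl (sym (identityˡ (- a))) p)

module SemihoopFacts (S : PrelinearSemihoop) where
  open PrelinearSemihoop S

  ·-commutativeSemigroup : CommutativeSemigroup _ _
  ·-commutativeSemigroup = record
    { _≈_ = _≡_
    ; _∙_ = _·_
    ; isCommutativeSemigroup = record
      { isSemigroup = record
        { isMagma = record { isEquivalence = isEquivalence ; ∙-cong = cong₂ _·_ }
        ; assoc = ·-assoc }
      ; comm = ·-comm } }

  open CommutativeSemigroupProperties ·-commutativeSemigroup public
    using (interchange; x∙yz≈y∙xz)

  ≤-resp-≡ : ∀ {a b a' b'} → a ≡ a' → b ≡ b' → a ≤ b → a' ≤ b'
  ≤-resp-≡ refl refl p = p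

  𝟙·-assoc : ∀ x y → 𝟙 · x · y ≡ x · y
  𝟙·-assoc x y = trans (·-assoc 𝟙 x y) (·-identity (x · y))

  𝟙𝟙·-identity : ∀ x → 𝟙 · 𝟙 · x ≡ x
  𝟙𝟙·-identity x = trans (𝟙·-assoc 𝟙 x) (·-identity x)

  -- Every element is below the top, so squaring decreases: x·x ≤ x.
  x·x≤x : ∀ x → x · x ≤ x
  x·x≤x x = ≤-resp-≡ refl (·-identity x) (·-isotone x 𝟙 x (∧-top x))

  square-· : ∀ x y → (x · y) · (x · y) ≡ (x · x) · (y · y)
  square-· x y = interchange x y x y

  ≤⇒cross-≤ : ∀ x y → x ≤ y → y · (x · x) ≤ (y · y) · x
  ≤⇒cross-≤ x y p =
    ≤-resp-≡ (x∙yz≈y∙xz x y x) (sym (·-assoc y y x)) (·-isotone x y (y · x) p)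

module StateExtension (R : RealNumbers) (S : PrelinearSemihoop)
                      (w : PrelinearSemihoop.H S → RealNumbers.ℝ R)
                      (w-state : IsState R S w) where
  open RealNumbers R renaming (_≤_ to _≤ℝ_; _+_ to _+ℝ_)
  open PrelinearSemihoop S
  open IsState w-state
  open RealFacts R

  w-cancel-≡ : ∀ z x y → z · x ≡ z · y → w x ≡ w y
  w-cancel-≡ z x y e = ∙-cancelˡ (w z) (w x) (w y)
    (trans (sym (mult z x)) (trans (cong w e) (mult z y)))

  w-cancel-≤ : ∀ z x y → z · x ≤ z · y → w x ≤ℝ w y
  w-cancel-≤ z x y p = +-cancelˡ-≤ (w x) (w y) (w z)
    (subst₂ _≤ℝ_ (mult z x) (mult z y) (mono (z · x) (z · y) p))

  σ : K R S → ℝ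
  σ (x , y) = w x -ℝ w y

  well-defined : ∀ a b → _∼_ R S a b → σ a ≡ σ b
  well-defined (x , y) (x' , y') (z , e) =
    cross-sum⇒diff≡ (w x) (w y) (w x') (w y')
      (trans (sym (mult x y')) (trans (w-cancel-≡ z (x · y') (x' · y) e') (mult x' y)))
    where
    e' : z · (x · y') ≡ z · (x' · y)
    e' = trans (sym (·-assoc z x y')) (trans e (·-assoc z x' y))

  additive : ∀ a b → σ (_⊕_ R S a b) ≡ σ a +ℝ σ b
  additive (x , y) (x' , y') =
    trans (cong₂ _-ℝ_ (mult x x') (mult y y')) (diff-of-sums (w x) (w y) (w x') (w y'))

  positive : ∀ a → _⊑_ R S (𝟘K R S) a → 0# ≤ℝ σ a
  positive (x , y) (z , p) = ≤⇒0≤diff (w y) (w x) (w-cancel-≤ (z · 𝟙) y x p)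

  extends-w : ∀ x → w x ≡ σ (h R S x)
  extends-w x = sym (trans (cong (_-ℝ w x) (mult x x)) (double-minus-self (w x)))

  σ-state : IsKState R S σ
  σ-state = record { wellDefined = well-defined ; additive = additive ; positive = positive }

module StateRestriction (R : RealNumbers) (S : PrelinearSemihoop)
                        (σ : K R S → RealNumbers.ℝ R)
                        (σ-state : IsKState R S σ) where
  open RealNumbers R renaming (_≤_ to _≤ℝ_; _+_ to _+ℝ_)
  open PrelinearSemihoop S
  open IsKState σ-state
  open RealFacts R
  open SemihoopFacts S

  cross-≡⇒∼ : ∀ x y x' y' → x · y' ≡ x' · y → _∼_ R S (x , y) (x' , y')
  cross-≡⇒∼ x y x' y' e = 𝟙 , trans (𝟙·-assoc x y') (trans e (sym (𝟙·-assoc x' y)))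

  -- σ vanishes on the diagonal: σ[p,p] is idempotent for +, hence zero.
  σ-diagonal : ∀ p → σ (p , p) ≡ 0#
  σ-diagonal p = identityʳ-unique (σ (p , p)) (σ (p , p)) (begin
    σ (p , p) +ℝ σ (p , p)  ≡⟨ sym (additive (p , p) (p , p)) ⟩
    σ (p · p , p · p)       ≡⟨ wellDefined _ _ (cross-≡⇒∼ (p · p) (p · p) p p (·-assoc p p p)) ⟩
    σ (p , p)               ∎)
    where open ≡-Reasoning

  σ-swap : ∀ x y → σ (y , x) ≡ - σ (x , y)
  σ-swap x y = inverseʳ-unique (σ (x , y)) (σ (y , x)) (begin
    σ (x , y) +ℝ σ (y , x)  ≡⟨ sym (additive (x , y) (y , x)) ⟩
    σ (x · y , y · x)       ≡⟨ cong (λ t → σ (x · y , t)) (·-comm y x) ⟩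
    σ (x · y , x · y)       ≡⟨ σ-diagonal (x · y) ⟩
    0#                      ∎)
    where open ≡-Reasoning

  σ-nonneg : ∀ x y → y ≤ x → 0# ≤ℝ σ (x , y)
  σ-nonneg x y p = positive (x , y) (𝟙 , ≤-resp-≡ (sym (𝟙𝟙·-identity y)) (sym (𝟙𝟙·-identity x)) p)

  σh : H → ℝ
  σh x = σ (h R S x)

  σh-nonpos : ∀ x → σh x ≤ℝ 0#
  σh-nonpos x = 0≤neg⇒≤0 (σh x)
    (subst₂ _≤ℝ_ refl (σ-swap (x · x) x) (σ-nonneg x (x · x) (x·x≤x x)))

  σh-unit : σh 𝟙 ≡ 0#
  σh-unit = trans (cong (λ t → σ (t , 𝟙)) (·-identity 𝟙)) (σ-diagonal 𝟙)

  -- h(x·y) = h x ⊕ h y, because squaring is multiplicative.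
  σh-mult : ∀ x y → σh (x · y) ≡ σh x +ℝ σh y
  σh-mult x y = trans (cong (λ t → σ (t , x · y)) (square-· x y)) (additive (x · x , x) (y · y , y))

  -- σh y − σh x = σ(h y ⊕ −h x) = σ[(y·y)·x, y·(x·x)] ≥ 0.
  σh-mono : ∀ x y → x ≤ y → σh x ≤ℝ σh y
  σh-mono x y p = 0≤diff⇒≤ (σh x) (σh y) (subst₂ _≤ℝ_ refl σ-diff
    (σ-nonneg ((y · y) · x) (y · (x · x)) (≤⇒cross-≤ x y p)))
    where
    σ-diff : σ ((y · y) · x , y · (x · x)) ≡ σh y -ℝ σh x
    σ-diff = trans (additive (y · y , y) (x , x · x)) (cong (σh y +ℝ_) (σ-swap (x · x) x))

  σh-state : IsState R S σh
  σh-state = record { nonpos = σh-nonpos ; unit = σh-unit ; mult = σh-mult ; mono = σh-mono }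

proposition4p4 : (R : RealNumbers) (S : PrelinearSemihoop) →
    ((w : PrelinearSemihoop.H S → RealNumbers.ℝ R) → IsState R S w →
      ∃ λ (σ : K R S → RealNumbers.ℝ R) →
        IsKState R S σ × (∀ x → w x ≡ σ (h R S x)))
    ×
    ((σ : K R S → RealNumbers.ℝ R) → IsKState R S σ →
      IsState R S (λ x → σ (h R S x)))
proposition4p4 R S = extend , restrict
  where
  extend : (w : PrelinearSemihoop.H S → RealNumbers.ℝ R) → IsState R S w →
           ∃ λ (σ : K R S → RealNumbers.ℝ R) → IsKState R S σ × (∀ x → w x ≡ σ (h R S x))
  extend w w-state = σ , σ-state , extends-w
    where open StateExtension R S w w-state

  restrict : (σ : K R S → RealNumbers.ℝ R) → IsKState R S σ → IsState R S (λ x → σ (h R S x))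
  restrict σ σ-state = σh-state
    where open StateRestriction R S σ σ-state
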